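{- Let $\mathbb K$ be a field of characteristic zero, $k\ge 2$, and $R=\mathbb K[x_1,\ldots,x_k]$. Let $\mathcal A$ be a central essential hyperplane arrangement in $\mathbb K^k$ defined by pairwise non-proportional linear forms $\ell_1,\ldots,\ell_n\in R$ with $\ell_i=x_i$ for $i=1,\ldots,k$. Suppose $\theta=Q_1\partial_1+\cdots+Q_k\partial_k$ is a logarithmic derivation of $\mathcal A$, where $Q_1,\ldots,Q_k\in R$ are homogeneous quadratic polynomials with no common divisor. Since $\theta(x_i)\in\langle x_i\rangle$, write $Q_i=L_ix_i$ with $L_i=b_{1,i}x_1+\cdots+b_{k,i}x_k$, $b_{u,i}\in\mathbb K$, for $i=1,\ldots,k$. For $u\neq v$ in $\{1,\ldots,k\}$ let $I_{u,v}\subseteq R$ be the ideal generated by the $k-1$ elements $$x_u(b_{v,u}-b_{v,v})+x_v(b_{u,v}-b_{u,u})$$ and $$x_ux_v(b_{w,u}-b_{w,v})+x_vx_w(b_{u,w}-b_{u,u})-x_ux_w(b_{v,w}-b_{v,v}),\quad w\in\{1,\ldots,k\}\setminus\{u,v\}.$$ If $\ell_j=p_{1,j}x_1+\cdots+p_{k,j}x_k$ is one of the defining forms of $\mathcal A$ with $p_{u,j}\neq 0$ and $p_{v,j}\neq 0$, then $[p_{1,j},\ldots,p_{k,j}]\in V(I_{u,v})\subseteq\mathbb P^{k-1}$.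
   Context: A logarithmic derivation of $\mathcal A$ is a $\mathbb K$-derivation $\theta=\sum_i P_i\partial_{x_i}$ of $R$ such that $\theta(\ell_i)\in\langle\ell_i\rangle$ for all $i=1,\ldots,n$; its degree is the common degree of the homogeneous $P_i$. $V(I)$ denotes the zero locus in $\mathbb P^{k-1}$ of a homogeneous ideal $I$. -}

module Defs where

open import Level using (_⊔_)
open import Algebra.Bundles using (CommutativeRing)
open import Data.Nat as ℕ using (ℕ; zero; suc)
open import Data.Fin as Fin using (Fin)
open import Data.Vec as Vec using (Vec)
open import Data.Vec.Properties using (≡-dec)
open import Data.List as List using (List; []; _∷_)
open import Data.Product using (_×_; _,_; ∃; Σ)
open import Data.Sum using (_⊎_)
open import Data.Bool using (if_then_else_)
open import Relation.Nullary using (¬_; yes; no)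
open import Relation.Nullary.Decidable using (⌊_⌋)
open import Relation.Binary.PropositionalEquality using (_≡_; _≢_)

module FieldNotions {c ℓ} (K : CommutativeRing c ℓ) where
  open CommutativeRing K

  natK : ℕ → Carrier
  natK zero    = 0#
  natK (suc n) = 1# + natK n

  IsField : Set (c ⊔ ℓ)
  IsField = (¬ (0# ≈ 1#)) × (∀ x → ¬ (x ≈ 0#) → ∃ λ y → (x * y) ≈ 1#)

  CharZero : Set ℓ
  CharZero = ∀ n → ¬ (natK (suc n) ≈ 0#)

-- The polynomial ring R = K[x_1,…,x_k].
-- A polynomial is a finite formal sum of terms (coefficient , exponent vector);
-- two polynomials are equal when all their monomial coefficients agree.
module PolyRing {c ℓ} (K : CommutativeRing c ℓ) (k : ℕ) where
  open CommutativeRing K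
  open FieldNotions K

  Mono : Set
  Mono = Vec ℕ k

  Poly : Set c
  Poly = List (Carrier × Mono)

  coeff : Poly → Mono → Carrier
  coeff [] m = 0#
  coeff ((a , e) ∷ p) m with ≡-dec ℕ._≟_ e m
  ... | yes _ = a + coeff p m
  ... | no  _ = coeff p m

  infix 4 _≈P_
  _≈P_ : Poly → Poly → Set ℓ
  p ≈P q = ∀ m → coeff p m ≈ coeff q m

  0P : Poly
  0P = []

  constP : Carrier → Poly
  constP a = (a , Vec.replicate k 0) ∷ []

  1P : Poly
  1P = constP 1#

  unitMono : Fin k → Mono
  unitMono i = Vec.tabulate (λ j → if ⌊ i Fin.≟ j ⌋ then 1 else 0)

  var : Fin k → Poly
  var i = (1# , unitMono i) ∷ []

  infixl 6 _+P_ _-P_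
  infixl 7 _*P_

  _+P_ : Poly → Poly → Poly
  p +P q = p List.++ q

  -P_ : Poly → Poly
  -P p = List.map (λ t → (- Data.Product.proj₁ t , Data.Product.proj₂ t)) p

  _-P_ : Poly → Poly → Poly
  p -P q = p +P (-P q)

  _*P_ : Poly → Poly → Poly
  p *P q = List.concatMap
    (λ s → List.map (λ t → (Data.Product.proj₁ s * Data.Product.proj₁ t ,
                            Vec.zipWith ℕ._+_ (Data.Product.proj₂ s) (Data.Product.proj₂ t))) q) p

  sumP : List Poly → Poly
  sumP = List.foldr _+P_ 0P

  pow : Carrier → ℕ → Carrier
  pow a zero    = 1#
  pow a (suc n) = a * pow a n

  evalMono : (Fin k → Carrier) → Mono → Carrier
  evalMono x e = Vec.foldr _ _*_ 1# (Vec.zipWith pow (Vec.tabulate x) e)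

  eval : Poly → (Fin k → Carrier) → Carrier
  eval p x = List.foldr (λ t r → Data.Product.proj₁ t * evalMono x (Data.Product.proj₂ t) + r) 0# p

  ∂ : Fin k → Poly → Poly
  ∂ i = List.map (λ t →
          ( natK (Vec.lookup (Data.Product.proj₂ t) i) * Data.Product.proj₁ t
          , Vec.tabulate (λ j → if ⌊ i Fin.≟ j ⌋
                                  then ℕ.pred (Vec.lookup (Data.Product.proj₂ t) j)
                                  else Vec.lookup (Data.Product.proj₂ t) j)))

  Derivation : Set c
  Derivation = Fin k → Poly

  applyDer : Derivation → Poly → Poly
  applyDer θ f = sumP (List.map (λ i → θ i *P ∂ i f) (List.allFin k))

  linForm : (Fin k → Carrier) → Poly
  linForm a = sumP (List.map (λ i → constP (a i) *P var i) (List.allFin k))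

  Homogeneous : ℕ → Poly → Set ℓ
  Homogeneous d f = ∀ m → ¬ (coeff f m ≈ 0#) → Vec.sum m ≡ d

  _∣P_ : Poly → Poly → Set (c ⊔ ℓ)
  g ∣P f = ∃ λ q → f ≈P q *P g

  IsUnit : Poly → Set (c ⊔ ℓ)
  IsUnit u = ∃ λ v → u *P v ≈P 1P

  NoCommonDivisor : (Fin k → Poly) → Set (c ⊔ ℓ)
  NoCommonDivisor Q = ∀ d → (∀ i → d ∣P Q i) → IsUnit d

  IsLogarithmic : {n : ℕ} → (Fin n → Poly) → Derivation → Set (c ⊔ ℓ)
  IsLogarithmic ℓs θ = ∀ j → ℓs j ∣P applyDer θ (ℓs j)

  data Ideal (G : Poly → Set c) : Poly → Set (c ⊔ ℓ) where
    gen  : ∀ {f} → G f → Ideal G f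
    zer  : Ideal G 0P
    add  : ∀ {f g} → Ideal G f → Ideal G g → Ideal G (f +P g)
    mul  : ∀ r {f} → Ideal G f → Ideal G (r *P f)
    resp : ∀ {f g} → f ≈P g → Ideal G f → Ideal G g

  -- (homogeneous coordinates of) a point lies in the zero locus V(I) of the ideal generated by G
  InV : (Poly → Set c) → (Fin k → Carrier) → Set (c ⊔ ℓ)
  InV G x = ∀ f → Ideal G f → eval f x ≈ 0#

  -- the generators of I_{u,v};  b w i = b_{w,i} is the coefficient of x_w in L_i
  gen₀ : (Fin k → Fin k → Carrier) → Fin k → Fin k → Poly
  gen₀ b u v = var u *P constP (b v u - b v v) +P var v *P constP (b u v - b u u)

  genW : (Fin k → Fin k → Carrier) → Fin k → Fin k → Fin k → Poly
  genW b u v w =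
        var u *P var v *P constP (b w u - b w v)
     +P var v *P var w *P constP (b u w - b u u)
     -P var u *P var w *P constP (b v w - b v v)

  Iuv-gens : (Fin k → Fin k → Carrier) → Fin k → Fin k → Poly → Set c
  Iuv-gens b u v f =
    (f ≡ gen₀ b u v) ⊎ (Σ (Fin k) λ w → (w ≢ u) × (w ≢ v) × (f ≡ genW b u v w))

  δ : Fin k → Fin k → Carrier
  δ i u = if ⌊ i Fin.≟ u ⌋ then 1# else 0#

  Scalar : Set c
  Scalar = Carrier

  infix 4 _≈K_
  _≈K_ : Scalar → Scalar → Set ℓ
  _≈K_ = _≈_

  infixl 7 _*K_
  _*K_ : Scalar → Scalar → Scalar
  _*K_ = _*_

  0K : Scalar
  0K = 0#

module Submission where

-- Write P = p_{·,j}.  Evaluating the identity θ(ℓ_j) = q ℓ_j at points y of the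
-- hyperplane ℓ_j(y) = 0 shows that the bilinear form
--     B(x,y) = Σ_i L_i(x) P_i y_i,     with B(y,y) = θ(ℓ_j)(y),
-- vanishes on the diagonal of that hyperplane, hence (polarisation) so does its
-- symmetrisation B(x,y) + B(y,x).  The points X_w = P_w e_u − P_u e_w lie on the
-- hyperplane; B(X_v,X_v) = −P_u P_v g₀ and B(X_v,X_w) + B(X_w,X_v) =
-- −P_u (g_w + P_w g₀), where g₀ and g_w are the values at P of the generators
-- of I_{u,v}.  Cancelling the nonzero P_u, P_v gives g₀ = g_w = 0, so every
-- generator, and therefore the whole ideal, vanishes at P.

open import Defs
open import Algebra.Bundles using (CommutativeRing)
open import Algebra.Solver.Ring.AlmostCommutativeRing
  using (fromCommutativeRing; _-Raw-AlmostCommutative⟶_; Induced-equivalence)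
open import Data.Bool using (if_then_else_)
open import Data.Empty using (⊥-elim)
open import Data.Fin as Fin using (Fin; zero; suc)
import Data.Fin.Properties as FinP
open import Data.Integer as ℤ using (ℤ; +_; -[1+_])
import Data.Integer.Properties as ℤP
open import Data.List as List using ([]; _∷_)
import Data.List.Properties as LP
open import Data.Maybe using (Maybe; just; nothing)
open import Data.Nat as ℕ using (ℕ; zero; suc)
import Data.Nat.Properties as ℕP
open import Data.Product using (_,_; proj₁; proj₂)
import Data.Sign as Sign
open import Data.Sum using (inj₁; inj₂)
open import Data.Vec as Vec using (Vec; []; _∷_)
import Data.Vec.Properties as VP
open import Function using (id)
open import Relation.Nullary using (¬_; yes; no)
open import Relation.Nullary.Decidable using (⌊_⌋)
open import Relation.Binary.PropositionalEquality as ≡ using (_≡_; _≢_)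

-- The canonical map ι : ℤ → K of an arbitrary commutative ring is a ring
-- morphism.  This is what the standard library's ring solver needs in
-- order to normalise polynomial identities in K with integer coefficients.
module IntegerCoefficients {c ℓ} (K : CommutativeRing c ℓ) where
  open CommutativeRing K
  open import Algebra.Properties.Ring ring
    using (-‿distribˡ-*; -‿distribʳ-*; -0#≈0#; -‿involutive; -‿+-comm)
  open import Algebra.Properties.Semiring.Mult semiring using (_×_; ×-homo-+; ×1-homo-*)
  open import Relation.Binary.Reasoning.Setoid setoid

  ι⁺ : ℕ → Carrier
  ι⁺ n = n × 1#

  ι : ℤ → Carrier
  ι (+ n)    = ι⁺ n
  ι -[1+ n ] = - ι⁺ (suc n)

  signed : Sign.Sign → Carrier → Carrier
  signed Sign.+ x = x
  signed Sign.- x = - x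

  signed-cong : ∀ s {x y} → x ≈ y → signed s x ≈ signed s y
  signed-cong Sign.+ x≈y = x≈y
  signed-cong Sign.- x≈y = -‿cong x≈y

  signed-* : ∀ s t x y → signed (s Sign.* t) (x * y) ≈ signed s x * signed t y
  signed-* Sign.+ Sign.+ x y = refl
  signed-* Sign.+ Sign.- x y = -‿distribʳ-* x y
  signed-* Sign.- Sign.+ x y = -‿distribˡ-* x y
  signed-* Sign.- Sign.- x y = begin
    x * y           ≈⟨ -‿involutive (x * y) ⟨
    - - (x * y)     ≈⟨ -‿cong (-‿distribˡ-* x y) ⟩
    - (- x * y)     ≈⟨ -‿distribʳ-* (- x) y ⟩
    - x * - y       ∎

  ι-◃ : ∀ s n → ι (s ℤ.◃ n) ≈ signed s (ι⁺ n)
  ι-◃ Sign.+ zero    = refl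
  ι-◃ Sign.- zero    = sym -0#≈0#
  ι-◃ Sign.+ (suc n) = refl
  ι-◃ Sign.- (suc n) = refl

  ι-sign-abs : ∀ i → ι i ≈ signed (ℤ.sign i) (ι⁺ ℤ.∣ i ∣)
  ι-sign-abs (+ n)    = refl
  ι-sign-abs -[1+ n ] = refl

  ι-* : ∀ i j → ι (i ℤ.* j) ≈ ι i * ι j
  ι-* i j = begin
    ι (ℤ.sign i Sign.* ℤ.sign j ℤ.◃ ℤ.∣ i ∣ ℕ.* ℤ.∣ j ∣)
      ≈⟨ ι-◃ (ℤ.sign i Sign.* ℤ.sign j) (ℤ.∣ i ∣ ℕ.* ℤ.∣ j ∣) ⟩
    signed (ℤ.sign i Sign.* ℤ.sign j) (ι⁺ (ℤ.∣ i ∣ ℕ.* ℤ.∣ j ∣))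
      ≈⟨ signed-cong (ℤ.sign i Sign.* ℤ.sign j) (×1-homo-* ℤ.∣ i ∣ ℤ.∣ j ∣) ⟩
    signed (ℤ.sign i Sign.* ℤ.sign j) (ι⁺ ℤ.∣ i ∣ * ι⁺ ℤ.∣ j ∣)
      ≈⟨ signed-* (ℤ.sign i) (ℤ.sign j) (ι⁺ ℤ.∣ i ∣) (ι⁺ ℤ.∣ j ∣) ⟩
    signed (ℤ.sign i) (ι⁺ ℤ.∣ i ∣) * signed (ℤ.sign j) (ι⁺ ℤ.∣ j ∣)
      ≈⟨ *-cong (ι-sign-abs i) (ι-sign-abs j) ⟨
    ι i * ι j ∎

  ι--‿ : ∀ i → ι (ℤ.- i) ≈ - ι i
  ι--‿ -[1+ n ]    = sym (-‿involutive _)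
  ι--‿ (+ zero)    = sym -0#≈0#
  ι--‿ (+ suc n)   = refl

  cancel-1 : ∀ a b → (1# + a) + - (1# + b) ≈ a + - b
  cancel-1 a b = begin
    (1# + a) + - (1# + b)     ≈⟨ +-congˡ (-‿+-comm 1# b) ⟨
    (1# + a) + (- 1# + - b)   ≈⟨ +-congʳ (+-comm 1# a) ⟩
    (a + 1#) + (- 1# + - b)   ≈⟨ +-assoc a 1# _ ⟩
    a + (1# + (- 1# + - b))   ≈⟨ +-congˡ (+-assoc 1# (- 1#) (- b)) ⟨
    a + ((1# + - 1#) + - b)   ≈⟨ +-congˡ (+-congʳ (-‿inverseʳ 1#)) ⟩
    a + (0# + - b)            ≈⟨ +-congˡ (+-identityˡ (- b)) ⟩
    a + - b                   ∎

  ι-⊖ : ∀ m n → ι (m ℤ.⊖ n) ≈ ι⁺ m + - ι⁺ n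
  ι-⊖ m zero = begin
    ι (m ℤ.⊖ 0)   ≈⟨ reflexive (≡.cong ι (ℤP.⊖-≥ {m} {0} ℕ.z≤n)) ⟩
    ι⁺ m          ≈⟨ +-identityʳ (ι⁺ m) ⟨
    ι⁺ m + 0#     ≈⟨ +-congˡ -0#≈0# ⟨
    ι⁺ m + - 0#   ∎
  ι-⊖ zero (suc n) = begin
    ι (0 ℤ.⊖ suc n)       ≈⟨ reflexive (≡.cong ι (ℤP.⊖-≤ {0} {suc n} ℕ.z≤n)) ⟩
    - ι⁺ (suc n)          ≈⟨ +-identityˡ _ ⟨
    0# + - ι⁺ (suc n)     ∎
  ι-⊖ (suc m) (suc n) = begin
    ι (suc m ℤ.⊖ suc n)   ≈⟨ reflexive (≡.cong ι (ℤP.[1+m]⊖[1+n]≡m⊖n m n)) ⟩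
    ι (m ℤ.⊖ n)           ≈⟨ ι-⊖ m n ⟩
    ι⁺ m + - ι⁺ n         ≈⟨ cancel-1 (ι⁺ m) (ι⁺ n) ⟨
    ι⁺ (suc m) + - ι⁺ (suc n) ∎

  ι-+ : ∀ i j → ι (i ℤ.+ j) ≈ ι i + ι j
  ι-+ -[1+ m ] -[1+ n ] = begin
    - ι⁺ (suc (suc (m ℕ.+ n)))          ≈⟨ -‿cong (reflexive (≡.cong (λ t → ι⁺ (suc t)) (ℕP.+-suc m n))) ⟨
    - ι⁺ (suc m ℕ.+ suc n)              ≈⟨ -‿cong (×-homo-+ 1# (suc m) (suc n)) ⟩
    - (ι⁺ (suc m) + ι⁺ (suc n))         ≈⟨ -‿+-comm (ι⁺ (suc m)) (ι⁺ (suc n)) ⟨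
    - ι⁺ (suc m) + - ι⁺ (suc n)         ∎
  ι-+ -[1+ m ] (+ n) = trans (ι-⊖ n (suc m)) (+-comm _ _)
  ι-+ (+ m) -[1+ n ] = ι-⊖ m (suc n)
  ι-+ (+ m) (+ n)    = ×-homo-+ 1# m n

  ι-morphism : ℤ.+-*-rawRing -Raw-AlmostCommutative⟶ fromCommutativeRing K
  ι-morphism = record
    { ⟦_⟧    = ι
    ; +-homo = ι-+
    ; *-homo = ι-*
    ; -‿homo = ι--‿
    ; 0-homo = refl
    ; 1-homo = +-identityʳ 1#
    }

  -- equality of integer coefficients is decidable, so the solver may
  -- identify equal constants
  ι-equal? : ∀ i j → Maybe (Induced-equivalence ι-morphism i j)
  ι-equal? i j with i ℤ.≟ j
  ... | yes ≡.refl = just refl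
  ... | no _       = nothing

  open import Algebra.Solver.Ring ℤ.+-*-rawRing (fromCommutativeRing K) ι-morphism ι-equal? public
    using (solve; _:+_; _:*_; :-_; _:-_; _:=_; con)

module Evaluation {c ℓ} (K : CommutativeRing c ℓ) (k : ℕ) where
  open CommutativeRing K hiding (zero)
  open FieldNotions K using (natK)
  open PolyRing K k
  open IntegerCoefficients K using (solve; _:+_; _:*_; :-_; _:=_; con)
  open import Relation.Binary.Reasoning.Setoid setoid
  open import Algebra.Properties.Semiring.Sum semiring using (sum-syntax; sum-cong-≋; sum-replicate-zero)

  pow-+ : ∀ a m n → pow a (m ℕ.+ n) ≈ pow a m * pow a n
  pow-+ a zero    n = sym (*-identityˡ _)
  pow-+ a (suc m) n = trans (*-congˡ (pow-+ a m n)) (sym (*-assoc _ _ _))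

  monomialValue : ∀ {n} → Vec Carrier n → Vec ℕ n → Carrier
  monomialValue xs e = Vec.foldr _ _*_ 1# (Vec.zipWith pow xs e)

  monomialValue-+ : ∀ {n} (xs : Vec Carrier n) e f →
    monomialValue xs (Vec.zipWith ℕ._+_ e f) ≈ monomialValue xs e * monomialValue xs f
  monomialValue-+ [] [] [] = sym (*-identityˡ _)
  monomialValue-+ (x ∷ xs) (a ∷ e) (b ∷ f) = begin
    pow x (a ℕ.+ b) * monomialValue xs (Vec.zipWith ℕ._+_ e f)
      ≈⟨ *-cong (pow-+ x a b) (monomialValue-+ xs e f) ⟩
    (pow x a * pow x b) * (monomialValue xs e * monomialValue xs f)
      ≈⟨ solve 4 (λ p q r s → (p :* q) :* (r :* s) := (p :* r) :* (q :* s)) refl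
           (pow x a) (pow x b) (monomialValue xs e) (monomialValue xs f) ⟩
    (pow x a * monomialValue xs e) * (pow x b * monomialValue xs f) ∎

  monomialValue-constant : ∀ {n} (xs : Vec Carrier n) e →
    (∀ j → Vec.lookup e j ≡ 0) → monomialValue xs e ≈ 1#
  monomialValue-constant []       []      e≡0 = refl
  monomialValue-constant (x ∷ xs) (a ∷ e) e≡0 rewrite e≡0 zero =
    trans (*-identityˡ _) (monomialValue-constant xs e (λ j → e≡0 (suc j)))

  monomialValue-variable : ∀ {n} (xs : Vec Carrier n) e i →
    Vec.lookup e i ≡ 1 → (∀ j → j ≢ i → Vec.lookup e j ≡ 0) → monomialValue xs e ≈ Vec.lookup xs i
  monomialValue-variable (x ∷ xs) (a ∷ e) zero a≡1 others≡0 rewrite a≡1 =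
    trans (*-cong (*-identityʳ x) (monomialValue-constant xs e (λ j → others≡0 (suc j) (λ ()))))
          (*-identityʳ x)
  monomialValue-variable (x ∷ xs) (a ∷ e) (suc i) e≡1 others≡0 rewrite others≡0 zero (λ ()) =
    trans (*-identityˡ _)
          (monomialValue-variable xs e i e≡1 (λ j j≢i → others≡0 (suc j) (λ sj≡si → j≢i (FinP.suc-injective sj≡si))))

  unitMono-diagonal : ∀ i → Vec.lookup (unitMono i) i ≡ 1
  unitMono-diagonal i rewrite VP.lookup∘tabulate (λ l → if ⌊ i Fin.≟ l ⌋ then 1 else 0) i with i Fin.≟ i
  ... | yes _   = ≡.refl
  ... | no i≢i  = ⊥-elim (i≢i ≡.refl)

  unitMono-off-diagonal : ∀ i j → j ≢ i → Vec.lookup (unitMono i) j ≡ 0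
  unitMono-off-diagonal i j j≢i rewrite VP.lookup∘tabulate (λ l → if ⌊ i Fin.≟ l ⌋ then 1 else 0) j with i Fin.≟ j
  ... | yes i≡j = ⊥-elim (j≢i (≡.sym i≡j))
  ... | no _    = ≡.refl

  eval-+P : ∀ f g x → eval (f +P g) x ≈ eval f x + eval g x
  eval-+P []            g x = sym (+-identityˡ _)
  eval-+P ((a , e) ∷ f) g x = trans (+-congˡ (eval-+P f g x)) (sym (+-assoc _ _ _))

  eval--P : ∀ f x → eval (-P f) x ≈ - eval f x
  eval--P []            x = solve 0 (con (+ 0) := :- con (+ 0)) refl
  eval--P ((a , e) ∷ f) x = trans (+-congˡ (eval--P f x))
    (solve 3 (λ a E r → :- a :* E :+ :- r := :- (a :* E :+ r)) refl a (evalMono x e) (eval f x))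

  eval-term-* : ∀ a e g x →
    eval (List.map (λ t → (a * proj₁ t , Vec.zipWith ℕ._+_ e (proj₂ t))) g) x ≈ (a * evalMono x e) * eval g x
  eval-term-* a e []            x = sym (zeroʳ _)
  eval-term-* a e ((b , f) ∷ g) x = begin
    (a * b) * evalMono x (Vec.zipWith ℕ._+_ e f) + eval (List.map (λ t → (a * proj₁ t , Vec.zipWith ℕ._+_ e (proj₂ t))) g) x
      ≈⟨ +-cong (*-congˡ (monomialValue-+ (Vec.tabulate x) e f)) (eval-term-* a e g x) ⟩
    (a * b) * (evalMono x e * evalMono x f) + (a * evalMono x e) * eval g x
      ≈⟨ solve 5 (λ a b E F G → (a :* b) :* (E :* F) :+ (a :* E) :* G := (a :* E) :* (b :* F :+ G)) refl
           a b (evalMono x e) (evalMono x f) (eval g x) ⟩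
    (a * evalMono x e) * (b * evalMono x f + eval g x) ∎

  eval-*P : ∀ f g x → eval (f *P g) x ≈ eval f x * eval g x
  eval-*P []            g x = sym (zeroˡ _)
  eval-*P ((a , e) ∷ f) g x =
    trans (eval-+P (List.map (λ t → (a * proj₁ t , Vec.zipWith ℕ._+_ e (proj₂ t))) g) (f *P g) x)
      (trans (+-cong (eval-term-* a e g x) (eval-*P f g x)) (sym (distribʳ _ _ _)))

  eval-constP : ∀ a x → eval (constP a) x ≈ a
  eval-constP a x = trans (+-identityʳ _)
    (trans (*-congˡ (monomialValue-constant (Vec.tabulate x) _ (λ j → VP.lookup-replicate j 0))) (*-identityʳ a))

  eval-var : ∀ i x → eval (var i) x ≈ x i
  eval-var i x = trans (+-identityʳ _) (trans (*-identityˡ _)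
    (trans (monomialValue-variable (Vec.tabulate x) (unitMono i) i (unitMono-diagonal i) (unitMono-off-diagonal i))
           (reflexive (VP.lookup∘tabulate x i))))

  eval-sumP : ∀ {n} (f : Fin n → Poly) x → eval (sumP (List.tabulate f)) x ≈ ∑[ i < n ] eval (f i) x
  eval-sumP {zero}  f x = refl
  eval-sumP {suc n} f x = trans (eval-+P (f zero) _ x) (+-congˡ (eval-sumP (λ i → f (suc i)) x))

  remove : Mono → Poly → Poly
  remove m [] = []
  remove m ((a , e) ∷ f) with VP.≡-dec ℕ._≟_ e m
  ... | yes _ = remove m f
  ... | no  _ = (a , e) ∷ remove m f

  eval-split : ∀ f m x → eval f x ≈ coeff f m * evalMono x m + eval (remove m f) x
  eval-split [] m x = solve 1 (λ E → con (+ 0) := con (+ 0) :* E :+ con (+ 0)) refl (evalMono x m)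
  eval-split ((a , e) ∷ f) m x with VP.≡-dec ℕ._≟_ e m
  ... | yes ≡.refl = trans (+-congˡ (eval-split f m x))
        (solve 4 (λ a E c d → a :* E :+ (c :* E :+ d) := (a :+ c) :* E :+ d) refl
           a (evalMono x e) (coeff f m) (eval (remove m f) x))
  ... | no _ = trans (+-congˡ (eval-split f m x))
        (solve 5 (λ a E c M d → a :* E :+ (c :* M :+ d) := c :* M :+ (a :* E :+ d)) refl
           a (evalMono x e) (coeff f m) (evalMono x m) (eval (remove m f) x))

  coeff-remove-same : ∀ f m → coeff (remove m f) m ≈ 0#
  coeff-remove-same [] m = refl
  coeff-remove-same ((a , e) ∷ f) m with VP.≡-dec ℕ._≟_ e m
  ... | yes _ = coeff-remove-same f m
  ... | no e≢m with VP.≡-dec ℕ._≟_ e m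
  ...   | yes e≡m = ⊥-elim (e≢m e≡m)
  ...   | no _    = coeff-remove-same f m

  coeff-remove-other : ∀ f m m′ → m′ ≢ m → coeff (remove m f) m′ ≈ coeff f m′
  coeff-remove-other [] m m′ _ = refl
  coeff-remove-other ((a , e) ∷ f) m m′ m′≢m with VP.≡-dec ℕ._≟_ e m
  ... | yes ≡.refl with VP.≡-dec ℕ._≟_ e m′
  ...   | yes ≡.refl = ⊥-elim (m′≢m ≡.refl)
  ...   | no _       = coeff-remove-other f m m′ m′≢m
  coeff-remove-other ((a , e) ∷ f) m m′ m′≢m | no _ with VP.≡-dec ℕ._≟_ e m′
  ...   | yes _ = +-congˡ (coeff-remove-other f m m′ m′≢m)
  ...   | no _  = coeff-remove-other f m m′ m′≢m

  remove-resp : ∀ f g m → f ≈P g → remove m f ≈P remove m g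
  remove-resp f g m f≈g m′ with VP.≡-dec ℕ._≟_ m′ m
  ... | yes ≡.refl = trans (coeff-remove-same f m) (sym (coeff-remove-same g m))
  ... | no m′≢m    = trans (coeff-remove-other f m m′ m′≢m)
                       (trans (f≈g m′) (sym (coeff-remove-other g m m′ m′≢m)))

  remove-length : ∀ f m → List.length (remove m f) ℕ.≤ List.length f
  remove-length [] m = ℕ.z≤n
  remove-length ((a , e) ∷ f) m with VP.≡-dec ℕ._≟_ e m
  ... | yes _ = ℕP.m≤n⇒m≤1+n (remove-length f m)
  ... | no _  = ℕ.s≤s (remove-length f m)

  remove-head-length : ∀ a f m → List.length (remove m ((a , m) ∷ f)) ℕ.≤ List.length f
  remove-head-length a f m with VP.≡-dec ℕ._≟_ m m
  ... | yes _   = remove-length f m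
  ... | no m≢m  = ⊥-elim (m≢m ≡.refl)

  split-step : ∀ f g m x → f ≈P g → eval (remove m f) x ≈ eval (remove m g) x → eval f x ≈ eval g x
  split-step f g m x f≈g rest =
    trans (eval-split f m x) (trans (+-cong (*-congʳ (f≈g m)) rest) (sym (eval-split g m x)))

  -- induction on the total number of terms, removing one monomial at a time
  eval-resp-bounded : ∀ n f g x → List.length f ℕ.+ List.length g ℕ.≤ n → f ≈P g → eval f x ≈ eval g x
  eval-resp-bounded n [] [] x _ _ = refl
  eval-resp-bounded (suc n) f@((a , m) ∷ f′) g x len f≈g =
    split-step f g m x f≈g (eval-resp-bounded n (remove m f) (remove m g) x
      (ℕP.≤-trans (ℕP.+-mono-≤ (remove-head-length a f′ m) (remove-length g m)) (ℕP.≤-pred len))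
      (remove-resp f g m f≈g))
  eval-resp-bounded (suc n) [] g@((a , m) ∷ g′) x len f≈g =
    split-step [] g m x f≈g (eval-resp-bounded n [] (remove m g) x
      (ℕP.≤-trans (remove-head-length a g′ m) (ℕP.≤-pred len)) (remove-resp [] g m f≈g))

  eval-resp : ∀ f g x → f ≈P g → eval f x ≈ eval g x
  eval-resp f g x = eval-resp-bounded _ f g x ℕP.≤-refl

  eval-linForm : ∀ a y → eval (linForm a) y ≈ ∑[ i < k ] (a i * y i)
  eval-linForm a y = begin
    eval (sumP (List.map h (List.allFin k))) y   ≡⟨ ≡.cong (λ fs → eval (sumP fs) y) (LP.map-tabulate id h) ⟩
    eval (sumP (List.tabulate h)) y              ≈⟨ eval-sumP h y ⟩
    ∑[ i < k ] eval (h i) y                      ≈⟨ sum-cong-≋ (λ i → trans (eval-*P (constP (a i)) (var i) y)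
                                                      (*-cong (eval-constP (a i) y) (eval-var i y))) ⟩
    ∑[ i < k ] (a i * y i)                       ∎
    where
    h : Fin k → Poly
    h i = constP (a i) *P var i

  ∑-indicator : ∀ {n} (f d : Fin n → Carrier) u → d u ≈ 1# → (∀ j → j ≢ u → d j ≈ 0#) →
    ∑[ j < n ] (f j * d j) ≈ f u
  ∑-indicator {suc n} f d zero du≈1 others≈0 =
    trans (+-cong (trans (*-congˡ du≈1) (*-identityʳ (f zero))) rest≈0) (+-identityʳ (f zero))
    where
    rest≈0 : ∑[ j < n ] (f (suc j) * d (suc j)) ≈ 0#
    rest≈0 = trans (sum-cong-≋ (λ j → trans (*-congˡ (others≈0 (suc j) (λ ()))) (zeroʳ (f (suc j)))))
                   (sum-replicate-zero n)
  ∑-indicator {suc n} f d (suc u) du≈1 others≈0 =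
    trans (+-cong (trans (*-congˡ (others≈0 zero (λ ()))) (zeroʳ (f zero)))
                  (∑-indicator (λ j → f (suc j)) (λ j → d (suc j)) u du≈1
                     (λ j j≢u → others≈0 (suc j) (λ sj≡su → j≢u (FinP.suc-injective sj≡su)))))
          (+-identityˡ (f (suc u)))

  δ-diagonal : ∀ u → δ u u ≈ 1#
  δ-diagonal u with u Fin.≟ u
  ... | yes _   = refl
  ... | no u≢u  = ⊥-elim (u≢u ≡.refl)

  δ-off-diagonal : ∀ j u → j ≢ u → δ j u ≈ 0#
  δ-off-diagonal j u j≢u with j Fin.≟ u
  ... | yes j≡u = ⊥-elim (j≢u j≡u)
  ... | no _    = refl

  ∑-δ : ∀ (f : Fin k → Carrier) u → ∑[ j < k ] (f j * δ j u) ≈ f u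
  ∑-δ f u = ∑-indicator f (λ j → δ j u) u (δ-diagonal u) (λ j j≢u → δ-off-diagonal j u j≢u)

  eval-∂-var : ∀ i j a x → eval (∂ i ((a , unitMono j) ∷ [])) x ≈ a * δ j i
  eval-∂-var i j a x with j Fin.≟ i
  ... | yes ≡.refl = begin
      natK (Vec.lookup (unitMono j) j) * a * evalMono x M + 0#   ≈⟨ +-identityʳ _ ⟩
      natK (Vec.lookup (unitMono j) j) * a * evalMono x M
        ≈⟨ *-cong (*-congʳ (reflexive (≡.cong natK (unitMono-diagonal j))))
                  (monomialValue-constant (Vec.tabulate x) M constant) ⟩
      (1# + 0#) * a * 1#                                          ≈⟨ *-identityʳ _ ⟩
      (1# + 0#) * a                                               ≈⟨ *-congʳ (+-identityʳ 1#) ⟩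
      1# * a                                                      ≈⟨ *-identityˡ a ⟩
      a                                                           ≈⟨ *-identityʳ a ⟨
      a * 1#                                                      ∎
    where
    M : Mono
    M = Vec.tabulate (λ l → if ⌊ j Fin.≟ l ⌋ then ℕ.pred (Vec.lookup (unitMono j) l) else Vec.lookup (unitMono j) l)
    constant : ∀ l → Vec.lookup M l ≡ 0
    constant l rewrite VP.lookup∘tabulate (λ l → if ⌊ j Fin.≟ l ⌋ then ℕ.pred (Vec.lookup (unitMono j) l)
                                                                else Vec.lookup (unitMono j) l) l
      with j Fin.≟ l
    ... | yes ≡.refl = ≡.cong ℕ.pred (unitMono-diagonal j)
    ... | no j≢l     = unitMono-off-diagonal j l (λ l≡j → j≢l (≡.sym l≡j))
  ... | no j≢i = begin
      natK (Vec.lookup (unitMono j) i) * a * evalMono x _ + 0#   ≈⟨ +-identityʳ _ ⟩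
      natK (Vec.lookup (unitMono j) i) * a * evalMono x _
        ≈⟨ *-congʳ (*-congʳ (reflexive (≡.cong natK (unitMono-off-diagonal j i (λ i≡j → j≢i (≡.sym i≡j)))))) ⟩
      0# * a * evalMono x _                                       ≈⟨ *-congʳ (zeroˡ a) ⟩
      0# * evalMono x _                                           ≈⟨ zeroˡ _ ⟩
      0#                                                          ≈⟨ zeroʳ a ⟨
      a * 0#                                                      ∎

  constP-*P-var : ∀ a j → constP a *P var j ≡ (a * 1# , unitMono j) ∷ []
  constP-*P-var a j = ≡.cong (λ e → (a * 1# , e) ∷ []) (VP.zipWith-identityˡ (λ _ → ≡.refl) (unitMono j))

  ∂-sumP : ∀ i fs → ∂ i (sumP fs) ≡ sumP (List.map (∂ i) fs)
  ∂-sumP i []       = ≡.refl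
  ∂-sumP i (f ∷ fs) = ≡.trans (LP.map-++ _ f (sumP fs)) (≡.cong (∂ i f +P_) (∂-sumP i fs))

  eval-∂-linForm : ∀ i a x → eval (∂ i (linForm a)) x ≈ a i
  eval-∂-linForm i a x = begin
    eval (∂ i (sumP (List.map h (List.allFin k)))) x
      ≡⟨ ≡.cong (λ f → eval f x) (≡.trans (∂-sumP i (List.map h (List.allFin k)))
           (≡.cong sumP (≡.trans (≡.sym (LP.map-∘ (List.allFin k))) (LP.map-tabulate id (λ j → ∂ i (h j)))))) ⟩
    eval (sumP (List.tabulate (λ j → ∂ i (h j)))) x   ≈⟨ eval-sumP (λ j → ∂ i (h j)) x ⟩
    ∑[ j < k ] eval (∂ i (h j)) x
      ≈⟨ sum-cong-≋ (λ j → trans (reflexive (≡.cong (λ f → eval (∂ i f) x) (constP-*P-var (a j) j)))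
                                 (eval-∂-var i j (a j * 1#) x)) ⟩
    ∑[ j < k ] ((a j * 1#) * δ j i)                  ≈⟨ ∑-δ (λ j → a j * 1#) i ⟩
    a i * 1#                                         ≈⟨ *-identityʳ (a i) ⟩
    a i                                              ∎
    where
    h : Fin k → Poly
    h j = constP (a j) *P var j

  eval-applyDer-linForm : ∀ θ a x → eval (applyDer θ (linForm a)) x ≈ ∑[ i < k ] (eval (θ i) x * a i)
  eval-applyDer-linForm θ a x = begin
    eval (sumP (List.map h (List.allFin k))) x   ≡⟨ ≡.cong (λ fs → eval (sumP fs) x) (LP.map-tabulate id h) ⟩
    eval (sumP (List.tabulate h)) x              ≈⟨ eval-sumP h x ⟩
    ∑[ i < k ] eval (h i) x                      ≈⟨ sum-cong-≋ (λ i → trans (eval-*P (θ i) _ x)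
                                                                          (*-congˡ (eval-∂-linForm i a x))) ⟩
    ∑[ i < k ] (eval (θ i) x * a i)              ∎
    where
    h : Fin k → Poly
    h i = θ i *P ∂ i (linForm a)

  ideal-vanishes : ∀ G x → (∀ f → G f → eval f x ≈ 0#) → InV G x
  ideal-vanishes G x gens≈0 f (gen Gf) = gens≈0 f Gf
  ideal-vanishes G x gens≈0 _ zer      = refl
  ideal-vanishes G x gens≈0 _ (add {f} {g} If Ig) =
    trans (eval-+P f g x)
          (trans (+-cong (ideal-vanishes G x gens≈0 f If) (ideal-vanishes G x gens≈0 g Ig)) (+-identityʳ 0#))
  ideal-vanishes G x gens≈0 _ (mul r {f} If) =
    trans (eval-*P r f x) (trans (*-congˡ (ideal-vanishes G x gens≈0 f If)) (zeroʳ (eval r x)))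
  ideal-vanishes G x gens≈0 g (resp {f} f≈g If) =
    trans (sym (eval-resp f g x f≈g)) (ideal-vanishes G x gens≈0 f If)

module FieldCancellation {c ℓ} (K : CommutativeRing c ℓ) (isField : FieldNotions.IsField K) where
  open CommutativeRing K
  open IntegerCoefficients K using (solve; _:*_; _:=_)
  open import Algebra.Properties.Ring ring using (-‿injective; -0#≈0#)
  open import Relation.Binary.Reasoning.Setoid setoid

  cancel-nonzero : ∀ a z → ¬ (a ≈ 0#) → a * z ≈ 0# → z ≈ 0#
  cancel-nonzero a z a≉0 az≈0 with proj₂ isField a a≉0
  ... | a⁻¹ , aa⁻¹≈1 = begin
    z               ≈⟨ *-identityˡ z ⟨
    1# * z          ≈⟨ *-congʳ aa⁻¹≈1 ⟨
    (a * a⁻¹) * z   ≈⟨ solve 3 (λ a b z → (a :* b) :* z := b :* (a :* z)) refl a a⁻¹ z ⟩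
    a⁻¹ * (a * z)   ≈⟨ *-congˡ az≈0 ⟩
    a⁻¹ * 0#        ≈⟨ zeroʳ a⁻¹ ⟩
    0#              ∎

  nonzero-* : ∀ a b → ¬ (a ≈ 0#) → ¬ (b ≈ 0#) → ¬ (a * b ≈ 0#)
  nonzero-* a b a≉0 b≉0 ab≈0 = b≉0 (cancel-nonzero a b a≉0 ab≈0)

  cancel-negated : ∀ a z → ¬ (a ≈ 0#) → a * - z ≈ 0# → z ≈ 0#
  cancel-negated a z a≉0 a[-z]≈0 = -‿injective (trans (cancel-nonzero a (- z) a≉0 a[-z]≈0) (sym -0#≈0#))

-- Fix the form ℓ = Σ_i P_i x_i and the coefficients b_{w,i} of the linear
-- forms L_i = Σ_w b_{w,i} x_w.  For θ = Σ_i L_i x_i ∂_i we have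
-- θ(ℓ)(y) = B(y,y) for the bilinear form  B(x,y) = Σ_i L_i(x) P_i y_i.
module LogarithmicForm {c ℓ} (K : CommutativeRing c ℓ) (k : ℕ)
                       (P : Fin k → CommutativeRing.Carrier K)
                       (b : Fin k → Fin k → CommutativeRing.Carrier K) where
  open CommutativeRing K hiding (zero)
  open PolyRing K k
  open Evaluation K k
  open IntegerCoefficients K using (solve; _:+_; _:*_; :-_; _:-_; _:=_; con)
  open import Algebra.Properties.Semiring.Sum semiring using (sum-syntax; sum-cong-≋; ∑-distrib-+)
  open import Relation.Binary.Reasoning.Setoid setoid

  Point : Set c
  Point = Fin k → Carrier

  _⊕_ : Point → Point → Point
  (x ⊕ y) i = x i + y i

  dot : Point → Point → Carrier
  dot a y = ∑[ i < k ] (a i * y i)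

  L : Fin k → Point → Carrier
  L i y = dot (λ w → b w i) y

  B : Point → Point → Carrier
  B x y = dot (λ i → L i x * P i) y

  dot-addˡ : ∀ a a′ y → dot (a ⊕ a′) y ≈ dot a y + dot a′ y
  dot-addˡ a a′ y = trans (sum-cong-≋ (λ i → distribʳ (y i) (a i) (a′ i)))
                     (∑-distrib-+ (λ i → a i * y i) (λ i → a′ i * y i))

  dot-addʳ : ∀ a x y → dot a (x ⊕ y) ≈ dot a x + dot a y
  dot-addʳ a x y = trans (sum-cong-≋ (λ i → distribˡ (a i) (x i) (y i)))
                     (∑-distrib-+ (λ i → a i * x i) (λ i → a i * y i))

  B-addˡ : ∀ x y z → B (x ⊕ y) z ≈ B x z + B y z
  B-addˡ x y z = begin
    dot (λ i → L i (x ⊕ y) * P i) z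
      ≈⟨ sum-cong-≋ (λ i → *-congʳ (*-congʳ (dot-addʳ (λ w → b w i) x y))) ⟩
    dot (λ i → (L i x + L i y) * P i) z              ≈⟨ sum-cong-≋ (λ i → *-congʳ (distribʳ (P i) (L i x) (L i y))) ⟩
    dot ((λ i → L i x * P i) ⊕ (λ i → L i y * P i)) z ≈⟨ dot-addˡ _ _ z ⟩
    B x z + B y z                                    ∎

  polarisation : ∀ x y → B (x ⊕ y) (x ⊕ y) ≈ (B x x + B y y) + (B x y + B y x)
  polarisation x y = begin
    B (x ⊕ y) (x ⊕ y)                     ≈⟨ B-addˡ x y (x ⊕ y) ⟩
    B x (x ⊕ y) + B y (x ⊕ y)             ≈⟨ +-cong (dot-addʳ (λ i → L i x * P i) x y)
                                                    (dot-addʳ (λ i → L i y * P i) x y) ⟩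
    (B x x + B x y) + (B y x + B y y)     ≈⟨ solve 4 (λ a b c d → (a :+ b) :+ (c :+ d) := (a :+ d) :+ (b :+ c)) refl
                                               (B x x) (B x y) (B y x) (B y y) ⟩
    (B x x + B y y) + (B x y + B y x)     ∎

  twoPoint : Carrier → Fin k → Carrier → Fin k → Point
  twoPoint α u β v i = α * δ i u + β * δ i v

  dot-twoPoint : ∀ a α u β v → dot a (twoPoint α u β v) ≈ a u * α + a v * β
  dot-twoPoint a α u β v = begin
    ∑[ i < k ] (a i * (α * δ i u + β * δ i v))
      ≈⟨ sum-cong-≋ (λ i → solve 5 (λ A α du β dv → A :* (α :* du :+ β :* dv) := (A :* α) :* du :+ (A :* β) :* dv)
                                 refl (a i) α (δ i u) β (δ i v)) ⟩
    ∑[ i < k ] ((a i * α) * δ i u + (a i * β) * δ i v)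
      ≈⟨ ∑-distrib-+ (λ i → (a i * α) * δ i u) (λ i → (a i * β) * δ i v) ⟩
    ∑[ i < k ] ((a i * α) * δ i u) + ∑[ i < k ] ((a i * β) * δ i v)
      ≈⟨ +-cong (∑-δ (λ i → a i * α) u) (∑-δ (λ i → a i * β) v) ⟩
    a u * α + a v * β ∎

  B-twoPoint : ∀ α u β v γ u′ η v′ →
    B (twoPoint α u β v) (twoPoint γ u′ η v′)
      ≈ ((b u u′ * α + b v u′ * β) * P u′) * γ + ((b u v′ * α + b v v′ * β) * P v′) * η
  B-twoPoint α u β v γ u′ η v′ =
    trans (dot-twoPoint (λ i → L i (twoPoint α u β v) * P i) γ u′ η v′)
          (+-cong (*-congʳ (*-congʳ (dot-twoPoint (λ w → b w u′) α u β v)))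
                  (*-congʳ (*-congʳ (dot-twoPoint (λ w → b w v′) α u β v))))

  form-vanishes-on-hyperplane : (Q : Fin k → Poly) → linForm P ∣P applyDer Q (linForm P) →
    (∀ i → Q i ≈P linForm (λ w → b w i) *P var i) → ∀ y → dot P y ≈ 0# → B y y ≈ 0#
  form-vanishes-on-hyperplane Q (q , θℓ≈qℓ) Q≈Lx y ℓy≈0 = begin
    ∑[ i < k ] ((L i y * P i) * y i)             ≈⟨ sum-cong-≋ (λ i → solve 3 (λ L p y → (L :* p) :* y := (L :* y) :* p) refl
                                                      (L i y) (P i) (y i)) ⟩
    ∑[ i < k ] ((L i y * y i) * P i)             ≈⟨ sum-cong-≋ (λ i → *-congʳ (eval-Q i)) ⟨
    ∑[ i < k ] (eval (Q i) y * P i)              ≈⟨ eval-applyDer-linForm Q P y ⟨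
    eval (applyDer Q (linForm P)) y              ≈⟨ eval-resp (applyDer Q (linForm P)) (q *P linForm P) y θℓ≈qℓ ⟩
    eval (q *P linForm P) y                      ≈⟨ eval-*P q (linForm P) y ⟩
    eval q y * eval (linForm P) y                ≈⟨ *-congˡ (trans (eval-linForm P y) ℓy≈0) ⟩
    eval q y * 0#                                ≈⟨ zeroʳ (eval q y) ⟩
    0#                                           ∎
    where
    eval-Q : ∀ i → eval (Q i) y ≈ L i y * y i
    eval-Q i = trans (eval-resp (Q i) (linForm (λ w → b w i) *P var i) y (Q≈Lx i))
      (trans (eval-*P (linForm (λ w → b w i)) (var i) y) (*-cong (eval-linForm (λ w → b w i) y) (eval-var i y)))

  symmetric-part-vanishes : (∀ y → dot P y ≈ 0# → B y y ≈ 0#) →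
    ∀ x y → dot P x ≈ 0# → dot P y ≈ 0# → B x y + B y x ≈ 0#
  symmetric-part-vanishes form≈0 x y ℓx≈0 ℓy≈0 = begin
    B x y + B y x                         ≈⟨ +-identityˡ _ ⟨
    0# + (B x y + B y x)
      ≈⟨ +-congʳ (trans (+-cong (form≈0 x ℓx≈0) (form≈0 y ℓy≈0)) (+-identityʳ 0#)) ⟨
    (B x x + B y y) + (B x y + B y x)     ≈⟨ polarisation x y ⟨
    B (x ⊕ y) (x ⊕ y)
      ≈⟨ form≈0 (x ⊕ y) (trans (dot-addʳ P x y) (trans (+-cong ℓx≈0 ℓy≈0) (+-identityʳ 0#))) ⟩
    0#                                    ∎

  module Generators (isField : FieldNotions.IsField K)
                    (form≈0 : ∀ y → dot P y ≈ 0# → B y y ≈ 0#)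
                    (u v : Fin k) (Pu≉0 : ¬ (P u ≈ 0#)) (Pv≉0 : ¬ (P v ≈ 0#)) where
    open FieldCancellation K isField

    g₀ : Carrier
    g₀ = P u * (b v u - b v v) + P v * (b u v - b u u)

    gW : Fin k → Carrier
    gW w = (P u * P v) * (b w u - b w v) + (P v * P w) * (b u w - b u u) - (P u * P w) * (b v w - b v v)

    X : Fin k → Point
    X w = twoPoint (P w) u (- P u) w

    X-on-hyperplane : ∀ w → dot P (X w) ≈ 0#
    X-on-hyperplane w = trans (dot-twoPoint P (P w) u (- P u) w)
      (solve 2 (λ a c → a :* c :+ c :* (:- a) := con (+ 0)) refl (P u) (P w))

    B-X-X : B (X v) (X v) ≈ (P u * P v) * - g₀
    B-X-X = trans (B-twoPoint (P v) u (- P u) v (P v) u (- P u) v)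
      (solve 6 (λ Pu Pv buu bvu buv bvv →
         ((buu :* Pv :+ bvu :* (:- Pu)) :* Pu) :* Pv :+ ((buv :* Pv :+ bvv :* (:- Pu)) :* Pv) :* (:- Pu)
         := (Pu :* Pv) :* (:- (Pu :* (bvu :- bvv) :+ Pv :* (buv :- buu)))) refl
         (P u) (P v) (b u u) (b v u) (b u v) (b v v))

    B-X-Y : ∀ w → B (X v) (X w) + B (X w) (X v) ≈ P u * - (gW w + P w * g₀)
    B-X-Y w = trans (+-cong (B-twoPoint (P v) u (- P u) v (P w) u (- P u) w)
                            (B-twoPoint (P w) u (- P u) w (P v) u (- P u) v))
      (solve 11 (λ Pu Pv Pw buu bvu buw bvw bwu buv bwv bvv →
         (((buu :* Pv :+ bvu :* (:- Pu)) :* Pu) :* Pw :+ ((buw :* Pv :+ bvw :* (:- Pu)) :* Pw) :* (:- Pu))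
         :+ (((buu :* Pw :+ bwu :* (:- Pu)) :* Pu) :* Pv :+ ((buv :* Pw :+ bwv :* (:- Pu)) :* Pv) :* (:- Pu))
         := Pu :* (:- (((Pu :* Pv) :* (bwu :- bwv) :+ (Pv :* Pw) :* (buw :- buu) :- (Pu :* Pw) :* (bvw :- bvv))
                        :+ Pw :* (Pu :* (bvu :- bvv) :+ Pv :* (buv :- buu))))) refl
         (P u) (P v) (P w) (b u u) (b v u) (b u w) (b v w) (b w u) (b u v) (b w v) (b v v))

    g₀≈0 : g₀ ≈ 0#
    g₀≈0 = cancel-negated (P u * P v) g₀ (nonzero-* (P u) (P v) Pu≉0 Pv≉0)
             (trans (sym B-X-X) (form≈0 (X v) (X-on-hyperplane v)))

    gW≈0 : ∀ w → gW w ≈ 0#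
    gW≈0 w = begin
      gW w               ≈⟨ +-identityʳ (gW w) ⟨
      gW w + 0#          ≈⟨ +-congˡ (trans (*-congˡ g₀≈0) (zeroʳ (P w))) ⟨
      gW w + P w * g₀    ≈⟨ cancel-negated (P u) _ Pu≉0 (trans (sym (B-X-Y w))
                              (symmetric-part-vanishes form≈0 (X v) (X w) (X-on-hyperplane v) (X-on-hyperplane w))) ⟩
      0#                 ∎

    eval-var-const : ∀ a e → eval (var a *P constP e) P ≈ P a * e
    eval-var-const a e = trans (eval-*P (var a) (constP e) P) (*-cong (eval-var a P) (eval-constP e P))

    eval-var-var-const : ∀ a a′ e → eval (var a *P var a′ *P constP e) P ≈ (P a * P a′) * e
    eval-var-var-const a a′ e = trans (eval-*P (var a *P var a′) (constP e) P)
      (*-cong (trans (eval-*P (var a) (var a′) P) (*-cong (eval-var a P) (eval-var a′ P))) (eval-constP e P))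

    eval-gen₀ : eval (gen₀ b u v) P ≈ g₀
    eval-gen₀ = trans (eval-+P (var u *P constP (b v u - b v v)) (var v *P constP (b u v - b u u)) P)
      (+-cong (eval-var-const u (b v u - b v v)) (eval-var-const v (b u v - b u u)))

    eval-genW : ∀ w → eval (genW b u v w) P ≈ gW w
    eval-genW w = begin
      eval (uv +P vw -P uw) P            ≈⟨ eval-+P (uv +P vw) (-P uw) P ⟩
      eval (uv +P vw) P + eval (-P uw) P ≈⟨ +-cong (eval-+P uv vw P) (eval--P uw P) ⟩
      (eval uv P + eval vw P) - eval uw P
        ≈⟨ +-cong (+-cong (eval-var-var-const u v (b w u - b w v)) (eval-var-var-const v w (b u w - b u u)))
                  (-‿cong (eval-var-var-const u w (b v w - b v v))) ⟩
      gW w                               ∎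
      where
      uv vw uw : Poly
      uv = var u *P var v *P constP (b w u - b w v)
      vw = var v *P var w *P constP (b u w - b u u)
      uw = var u *P var w *P constP (b v w - b v v)

    generators-vanish : ∀ f → Iuv-gens b u v f → eval f P ≈ 0#
    generators-vanish _ (inj₁ ≡.refl)                = trans eval-gen₀ g₀≈0
    generators-vanish _ (inj₂ (w , _ , _ , ≡.refl))  = trans (eval-genW w) (gW≈0 w)

open import Data.Nat using (_≤_; _+_)
open import Data.Fin using (_↑ˡ_)
open import Data.Product using (∃)

-- Lemma 2.1.
lemma2p1 : ∀ {c ℓ} (K : CommutativeRing c ℓ)
    → FieldNotions.IsField K → FieldNotions.CharZero K
    → (k : ℕ) → 2 ≤ k → (m : ℕ)
    → let open PolyRing K k in (p : Fin (k + m) → Fin k → Scalar)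
    → (∀ i u → p (i ↑ˡ m) u ≈K δ i u)
    → (∀ j → ¬ (∀ u → p j u ≈K 0K))
    → (∀ i j → i ≢ j → ¬ (∃ λ a → ∀ u → p i u ≈K a *K p j u))
    → (Q : Fin k → Poly)
    → (∀ i → Homogeneous 2 (Q i))
    → IsLogarithmic (λ j → linForm (p j)) Q
    → NoCommonDivisor Q
    → (b : Fin k → Fin k → Scalar)
    → (∀ i → Q i ≈P linForm (λ w → b w i) *P var i)
    → ∀ u v → u ≢ v → ∀ j → ¬ (p j u ≈K 0K) → ¬ (p j v ≈K 0K)
    → InV (Iuv-gens b u v) (p j)
lemma2p1 K isField _ k _ m p _ _ _ Q _ logarithmic _ b Q≈Lx u v _ j pju≉0 pjv≉0 =
  ideal-vanishes (Iuv-gens b u v) (p j) generators-vanish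
  where
  open PolyRing K k using (Iuv-gens)
  open Evaluation K k using (ideal-vanishes)
  open LogarithmicForm K k (p j) b using (module Generators; form-vanishes-on-hyperplane)
  open Generators isField (form-vanishes-on-hyperplane Q (logarithmic j) Q≈Lx) u v pju≉0 pjv≉0
    using (generators-vanish)
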